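{- If $1\le\delta<\Delta$ are integers with $\delta\Delta$ odd, then the family $\mathcal{L}_{\delta,\Delta}$ is non-empty.
   Context: All graphs are finite and simple. For $1\le\delta<\Delta$ with $\delta\Delta$ odd, $\mathcal{L}_{\delta,\Delta}$ is the family of graphs having exactly $\Delta+3$ vertices, namely a unique vertex of degree $\delta$ and $\Delta+2$ vertices of degree $\Delta$. -}

module Defs where

open import Data.Nat using (ℕ; _+_)
open import Data.Bool using (Bool; false; T?)
open import Data.Fin using (Fin)
open import Data.List using (filter; length; allFin)
open import Data.Product using (Σ; _×_)
open import Relation.Binary.PropositionalEquality using (_≡_; _≢_)

record SimpleGraph (n : ℕ) : Set where
  field
    adj     : Fin n → Fin n → Bool
    symm    : ∀ u v → adj u v ≡ adj v u
    irrefl  : ∀ v → adj v v ≡ false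
open SimpleGraph public

degree : ∀ {n} → SimpleGraph n → Fin n → ℕ
degree G v = length (filter (λ u → T? (adj G v u)) (allFin _))

InL : (δ Δ : ℕ) → SimpleGraph (Δ + 3) → Set
InL δ Δ G = Σ (Fin (Δ + 3)) λ v →
  (degree G v ≡ δ) × (∀ u → u ≢ v → degree G u ≡ Δ)

-- Induction on (δ, Δ) in steps of two.  A 1-regular graph on four vertices
-- starts it; adding two new vertices joined to every non-hub vertex raises Δ
-- by two, and additionally re-wiring the triangle formed by the hub, the new
-- vertex b and the hub's non-neighbour x (swap the edge bx for hb and hx)
-- raises δ by two as well.
module Submission where

open import Defs
open import Data.Nat using (ℕ; _*_; _+_; _≤_; _<_; _%_)
open import Data.Product using (Σ)
open import Relation.Binary.PropositionalEquality using (_≡_)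

open import Data.Nat using (zero; suc; _/_; _∸_; s≤s)
open import Data.Nat.Properties
  using (+-comm; +-assoc; +-suc; *-comm; *-distribʳ-+; *-cancelʳ-≤; ≤-pred; <⇒≤; m∸n+n≡m; 0≢1+n)
open import Data.Nat.DivMod using (m≡m%n+[m/n]*n; %-distribˡ-*; m%n<n)
open import Data.Bool using (Bool; true; false; not; T?; if_then_else_)
open import Data.Bool.Properties using () renaming (_≟_ to _≟ᵇ_)
open import Data.Fin using (Fin; zero; suc)
open import Data.Fin.Properties using (all?)
open import Data.List using (filter; length; tabulate)
open import Data.Product using (∃₂; _,_; _×_)
open import Data.Empty using (⊥-elim)
open import Relation.Nullary.Decidable using (toWitness)
open import Relation.Binary.PropositionalEquality
  using (refl; sym; trans; cong; cong₂; subst; subst₂; _≢_; module ≡-Reasoning)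

open ≡-Reasoning

Bool→ℕ : Bool → ℕ
Bool→ℕ true  = 1
Bool→ℕ false = 0

count : ∀ {n} → (Fin n → Bool) → ℕ
count {zero}  f = 0
count {suc n} f = Bool→ℕ (f zero) + count (λ i → f (suc i))

count-const-true : ∀ n → count {n} (λ _ → true) ≡ n
count-const-true zero    = refl
count-const-true (suc n) = cong suc (count-const-true n)

Bool→ℕ-+-not : ∀ b → Bool→ℕ b + Bool→ℕ (not b) ≡ 1
Bool→ℕ-+-not true  = refl
Bool→ℕ-+-not false = refl

length-filter-tabulate : ∀ {m} n (g : Fin n → Fin m) (f : Fin m → Bool) →
  length (filter (λ u → T? (f u)) (tabulate g)) ≡ count (λ i → f (g i))
length-filter-tabulate zero    g f = refl
length-filter-tabulate (suc n) g f with f (g zero)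
... | true  = cong suc (length-filter-tabulate n (λ i → g (suc i)) f)
... | false = length-filter-tabulate n (λ i → g (suc i)) f

degree≡count : ∀ {n} (G : SimpleGraph n) v → degree G v ≡ count (adj G v)
degree≡count {n} G v = length-filter-tabulate n (λ i → i) (adj G v)

LGraph : ℕ → ℕ → ℕ → Set
LGraph n δ Δ = Σ (SimpleGraph n) λ G → Σ (Fin n) λ v →
  (degree G v ≡ δ) × (∀ u → u ≢ v → degree G u ≡ Δ)

-- The hub is vertex zero; its non-neighbour 1 is the x of the raising step.
record HubGraph (δ Δ : ℕ) : Set where
  field
    graph        : SimpleGraph (3 + Δ)
    degree-hub   : degree graph zero ≡ δ
    degree-other : ∀ i → degree graph (suc i) ≡ Δ
    hub≁1        : adj graph zero (suc zero) ≡ false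

HubGraph⇒LGraph : ∀ {δ Δ} → HubGraph δ Δ → LGraph (3 + Δ) δ Δ
HubGraph⇒LGraph {Δ = Δ} h = graph , zero , degree-hub , degree-nonhub
  where
  open HubGraph h
  degree-nonhub : ∀ u → u ≢ zero → degree graph u ≡ Δ
  degree-nonhub zero    u≢0 = ⊥-elim (u≢0 refl)
  degree-nonhub (suc i) _   = degree-other i

matching₄ : SimpleGraph 4
matching₄ = record { adj = A ; symm = A-symm ; irrefl = A-irrefl }
  where
  A : Fin 4 → Fin 4 → Bool
  A zero                    (suc (suc zero))       = true
  A (suc (suc zero))        zero                   = true
  A (suc zero)              (suc (suc (suc zero))) = true
  A (suc (suc (suc zero)))  (suc zero)             = true
  A _                       _                      = false
  A-symm : ∀ u v → A u v ≡ A v u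
  A-symm = toWitness {a? = all? λ u → all? λ v → A u v ≟ᵇ A v u} _
  A-irrefl : ∀ v → A v v ≡ false
  A-irrefl = toWitness {a? = all? λ v → A v v ≟ᵇ false} _

hubGraph-base : HubGraph 1 1
hubGraph-base = record
  { graph        = matching₄
  ; degree-hub   = refl
  ; degree-other = λ { zero → refl ; (suc zero) → refl ; (suc (suc zero)) → refl }
  ; hub≁1        = refl
  }

-- New vertices: 1 = a (joined to all old non-hub vertices), 2 = b; old vertex
-- suc i becomes suc (suc (suc i)).  With raise = true the edges hub–b and
-- hub–x are added and b–x is dropped, x = old vertex 1 = new vertex 3.
module Extension (raise : Bool) {δ Δ : ℕ} (h : HubGraph δ Δ) where
  open HubGraph h

  A : Fin (3 + Δ) → Fin (3 + Δ) → Bool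
  A = adj graph

  B : Fin (5 + Δ) → Fin (5 + Δ) → Bool
  B zero                 zero                       = false
  B zero                 (suc zero)                 = false
  B zero                 (suc (suc zero))           = raise
  B zero                 (suc (suc (suc zero)))     = raise
  B zero                 (suc (suc (suc (suc j))))  = A zero (suc (suc j))
  B (suc zero)           zero                       = false
  B (suc zero)           (suc zero)                 = false
  B (suc zero)           (suc (suc zero))           = false
  B (suc zero)           (suc (suc (suc j)))        = true
  B (suc (suc zero))     zero                       = raise
  B (suc (suc zero))     (suc zero)                 = false
  B (suc (suc zero))     (suc (suc zero))           = false
  B (suc (suc zero))     (suc (suc (suc zero)))     = not raise
  B (suc (suc zero))     (suc (suc (suc (suc j))))  = true
  B (suc (suc (suc i)))  (suc (suc (suc j)))        = A (suc i) (suc j)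
  B (suc (suc (suc i)))  (suc zero)                 = true
  B (suc (suc (suc zero)))     zero                 = raise
  B (suc (suc (suc (suc i)))) zero                  = A zero (suc (suc i))
  B (suc (suc (suc zero)))     (suc (suc zero))     = not raise
  B (suc (suc (suc (suc i)))) (suc (suc zero))      = true

  B-symm : ∀ u v → B u v ≡ B v u
  B-symm zero                 zero                       = refl
  B-symm zero                 (suc zero)                 = refl
  B-symm zero                 (suc (suc zero))           = refl
  B-symm zero                 (suc (suc (suc zero)))     = refl
  B-symm zero                 (suc (suc (suc (suc j))))  = refl
  B-symm (suc zero)           zero                       = refl
  B-symm (suc zero)           (suc zero)                 = refl
  B-symm (suc zero)           (suc (suc zero))           = refl
  B-symm (suc zero)           (suc (suc (suc zero)))     = refl
  B-symm (suc zero)           (suc (suc (suc (suc j))))  = refl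
  B-symm (suc (suc zero))     zero                       = refl
  B-symm (suc (suc zero))     (suc zero)                 = refl
  B-symm (suc (suc zero))     (suc (suc zero))           = refl
  B-symm (suc (suc zero))     (suc (suc (suc zero)))     = refl
  B-symm (suc (suc zero))     (suc (suc (suc (suc j))))  = refl
  B-symm (suc (suc (suc zero)))     zero                 = refl
  B-symm (suc (suc (suc (suc i)))) zero                  = refl
  B-symm (suc (suc (suc zero)))     (suc zero)           = refl
  B-symm (suc (suc (suc (suc i)))) (suc zero)            = refl
  B-symm (suc (suc (suc zero)))     (suc (suc zero))     = refl
  B-symm (suc (suc (suc (suc i)))) (suc (suc zero))      = refl
  B-symm (suc (suc (suc i)))  (suc (suc (suc j)))        = symm graph (suc i) (suc j)

  B-irrefl : ∀ v → B v v ≡ false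
  B-irrefl zero                = refl
  B-irrefl (suc zero)          = refl
  B-irrefl (suc (suc zero))    = refl
  B-irrefl (suc (suc (suc i))) = irrefl graph (suc i)

  graph′ : SimpleGraph (5 + Δ)
  graph′ = record { adj = B ; symm = B-symm ; irrefl = B-irrefl }

  old-degree : ∀ v → count (A v) ≡ degree graph v
  old-degree v = sym (degree≡count graph v)

  degree-hub′ : degree graph′ zero ≡ (if raise then 2 + δ else δ)
  degree-hub′ = trans (degree≡count graph′ zero) (count-hub-row raise)
    where
    X : ℕ
    X = count (λ j → A zero (suc (suc j)))
    X≡δ : X ≡ δ
    X≡δ = begin
      X                   ≡⟨ cong₂ (λ a b → Bool→ℕ a + (Bool→ℕ b + X)) (sym (irrefl graph zero)) (sym hub≁1) ⟩
      count (A zero)      ≡⟨ old-degree zero ⟩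
      degree graph zero   ≡⟨ degree-hub ⟩
      δ                   ∎
    count-hub-row : ∀ b → Bool→ℕ b + (Bool→ℕ b + X) ≡ (if b then 2 + δ else δ)
    count-hub-row true  = cong (λ k → suc (suc k)) X≡δ
    count-hub-row false = X≡δ

  -- Raising trades b's neighbour x, and x's neighbour b, for the hub; so in
  -- their rows raise only contributes Bool→ℕ raise + Bool→ℕ (not raise) = 1.
  degree-other′ : ∀ i → degree graph′ (suc i) ≡ 2 + Δ
  degree-other′ i = trans (degree≡count graph′ (suc i)) (count-row i)
    where
    Y : Fin (2 + Δ) → ℕ
    Y v = count (λ j → A (suc v) (suc j))
    old-row : ∀ v → Bool→ℕ (A (suc v) zero) + Y v ≡ Δ
    old-row v = trans (old-degree (suc v)) (degree-other v)
    x≁hub : A (suc zero) zero ≡ false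
    x≁hub = trans (symm graph (suc zero) zero) hub≁1
    count-row : ∀ i → count (B (suc i)) ≡ 2 + Δ
    count-row zero = count-const-true (2 + Δ)
    count-row (suc zero) = begin
      Bool→ℕ raise + (Bool→ℕ (not raise) + count {suc Δ} (λ _ → true))
        ≡⟨ sym (+-assoc (Bool→ℕ raise) _ _) ⟩
      Bool→ℕ raise + Bool→ℕ (not raise) + count {suc Δ} (λ _ → true)
        ≡⟨ cong₂ _+_ (Bool→ℕ-+-not raise) (count-const-true (suc Δ)) ⟩
      2 + Δ ∎
    count-row (suc (suc zero)) = begin
      Bool→ℕ raise + suc (Bool→ℕ (not raise) + Y zero)
        ≡⟨ +-suc (Bool→ℕ raise) _ ⟩
      suc (Bool→ℕ raise + (Bool→ℕ (not raise) + Y zero))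
        ≡⟨ cong suc (sym (+-assoc (Bool→ℕ raise) _ _)) ⟩
      suc (Bool→ℕ raise + Bool→ℕ (not raise) + Y zero)
        ≡⟨ cong₂ (λ m n → suc (m + n)) (Bool→ℕ-+-not raise) (trans (cong (λ b → Bool→ℕ b + Y zero) (sym x≁hub)) (old-row zero)) ⟩
      2 + Δ ∎
    count-row (suc (suc (suc i))) = begin
      Bool→ℕ (A zero (suc (suc i))) + suc (suc (Y (suc i)))
        ≡⟨ trans (+-suc _ _) (cong suc (+-suc _ _)) ⟩
      2 + (Bool→ℕ (A zero (suc (suc i))) + Y (suc i))
        ≡⟨ cong (λ b → 2 + (Bool→ℕ b + Y (suc i))) (symm graph zero (suc (suc i))) ⟩
      2 + (Bool→ℕ (A (suc (suc i)) zero) + Y (suc i))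
        ≡⟨ cong (2 +_) (old-row (suc i)) ⟩
      2 + Δ ∎

  extended : HubGraph (if raise then 2 + δ else δ) (2 + Δ)
  extended = record
    { graph = graph′ ; degree-hub = degree-hub′ ; degree-other = degree-other′ ; hub≁1 = refl }

hubGraph-regular : ∀ p → HubGraph (suc (p * 2)) (suc (p * 2))
hubGraph-regular zero    = hubGraph-base
hubGraph-regular (suc p) = Extension.extended true (hubGraph-regular p)

hubGraph : ∀ p r → HubGraph (suc (p * 2)) (r * 2 + suc (p * 2))
hubGraph p zero    = hubGraph-regular p
hubGraph p (suc r) = Extension.extended false (hubGraph p r)

m*n%2≡1⇒m%2≡1 : ∀ m n → (m * n) % 2 ≡ 1 → m % 2 ≡ 1
m*n%2≡1⇒m%2≡1 m n mn-odd with m % 2 | m%n<n m 2 | %-distribˡ-* m n 2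
... | 0           | _ | mn%2≡0 = ⊥-elim (0≢1+n (trans (sym mn%2≡0) mn-odd))
... | 1           | _ | _      = refl
... | suc (suc _) | s≤s (s≤s ()) | _

m%2≡1⇒m≡1+[m/2]*2 : ∀ m → m % 2 ≡ 1 → m ≡ suc (m / 2 * 2)
m%2≡1⇒m≡1+[m/2]*2 m m-odd = trans (m≡m%n+[m/n]*n m 2) (cong (_+ m / 2 * 2) m-odd)

odd≤odd⇒half-decomposition : ∀ {m n} → m % 2 ≡ 1 → n % 2 ≡ 1 → m ≤ n →
  ∃₂ λ p r → m ≡ suc (p * 2) × n ≡ r * 2 + m
odd≤odd⇒half-decomposition {m} {n} m-odd n-odd m≤n =
  m / 2 , n / 2 ∸ m / 2 , m≡1+p*2 , n≡r*2+m
  where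
  m≡1+p*2 : m ≡ suc (m / 2 * 2)
  m≡1+p*2 = m%2≡1⇒m≡1+[m/2]*2 m m-odd
  n≡1+q*2 : n ≡ suc (n / 2 * 2)
  n≡1+q*2 = m%2≡1⇒m≡1+[m/2]*2 n n-odd
  p≤q : m / 2 ≤ n / 2
  p≤q = *-cancelʳ-≤ (m / 2) (n / 2) 2 (≤-pred (subst₂ _≤_ m≡1+p*2 n≡1+q*2 m≤n))
  n≡r*2+m : n ≡ (n / 2 ∸ m / 2) * 2 + m
  n≡r*2+m = begin
    n                                           ≡⟨ n≡1+q*2 ⟩
    suc (n / 2 * 2)                             ≡⟨ cong (λ k → suc (k * 2)) (sym (m∸n+n≡m p≤q)) ⟩
    suc ((n / 2 ∸ m / 2 + m / 2) * 2)           ≡⟨ cong suc (*-distribʳ-+ 2 (n / 2 ∸ m / 2) (m / 2)) ⟩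
    suc ((n / 2 ∸ m / 2) * 2 + m / 2 * 2)       ≡⟨ sym (+-suc _ _) ⟩
    (n / 2 ∸ m / 2) * 2 + suc (m / 2 * 2)       ≡⟨ cong ((n / 2 ∸ m / 2) * 2 +_) (sym m≡1+p*2) ⟩
    (n / 2 ∸ m / 2) * 2 + m                     ∎

proposition2p14 : (δ Δ : ℕ) → 1 ≤ δ → δ < Δ → (δ * Δ) % 2 ≡ 1 →
    Σ (SimpleGraph (Δ + 3)) (λ G → InL δ Δ G)
-- The hypothesis 1 ≤ δ is implied by δ being odd.
proposition2p14 δ Δ _ δ<Δ δΔ-odd
  with odd≤odd⇒half-decomposition δ-odd Δ-odd (<⇒≤ δ<Δ)
  where
  δ-odd : δ % 2 ≡ 1
  δ-odd = m*n%2≡1⇒m%2≡1 δ Δ δΔ-odd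
  Δ-odd : Δ % 2 ≡ 1
  Δ-odd = m*n%2≡1⇒m%2≡1 Δ δ (trans (cong (_% 2) (*-comm Δ δ)) δΔ-odd)
... | p , r , refl , refl =
  subst (λ n → LGraph n δ Δ) (+-comm 3 Δ) (HubGraph⇒LGraph (hubGraph p r))
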